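{- Let $G$ be a directed graph and consider packings consisting of vertex-disjoint cycles of length 2 or 3, where the cardinality of a packing is the number of vertices it covers. Any vertex that lies on some 2-cycle or 3-cycle of $G$ is covered by some such packing whose cardinality is at most 3 less than the maximum cardinality. More generally, if cycles of length up to $L$ are allowed, any vertex lying on some cycle of length at most $L$ is covered by some such packing whose cardinality is at most $(L-1)^2-1$ less than the maximum cardinality. -}

module Defs where

open import Data.Nat using (ℕ; _≤_)
open import Data.Fin using (Fin)
open import Data.Bool using (Bool; T)
open import Data.List using (List; []; _∷_; _++_; [_]; length; concat)
open import Data.List.Relation.Unary.All using (All)
open import Data.List.Relation.Unary.Unique.Propositional using (Unique)
open import Data.List.Membership.Propositional using (_∈_)
open import Data.Product using (_×_; ∃)
open import Data.Unit using (⊤)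
open import Data.Empty using (⊥)

Digraph : ℕ → Set
Digraph n = Fin n → Fin n → Bool

PathArcs : ∀ {n} → Digraph n → List (Fin n) → Set
PathArcs G []           = ⊤
PathArcs G (x ∷ [])     = ⊤
PathArcs G (x ∷ y ∷ r)  = T (G x y) × PathArcs G (y ∷ r)

ClosedArcs : ∀ {n} → Digraph n → List (Fin n) → Set
ClosedArcs G []       = ⊥
ClosedArcs G (v ∷ vs) = PathArcs G (v ∷ vs ++ [ v ])

IsCycle : ∀ {n} → Digraph n → List (Fin n) → Set
IsCycle G c = 2 ≤ length c × Unique c × ClosedArcs G c

IsShortCycle : ∀ {n} → Digraph n → ℕ → List (Fin n) → Set
IsShortCycle G L c = IsCycle G c × length c ≤ L

covered : ∀ {n} → List (List (Fin n)) → List (Fin n)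
covered = concat

IsPacking : ∀ {n} → Digraph n → ℕ → List (List (Fin n)) → Set
IsPacking G L P = All (IsShortCycle G L) P × Unique (covered P)

size : ∀ {n} → List (List (Fin n)) → ℕ
size P = length (covered P)

{-# OPTIONS --safe #-}
module Submission where

-- Take a packing M of maximum cardinality. If it misses v, let c be a short
-- cycle through v and replace the cycles of M that meet c by c itself. Those
-- cycles are disjoint and each contains a vertex of c other than v, so there
-- are w < |c| ≤ L of them and they cover at most L w vertices. The loss is
-- therefore at most L w − |c| ≤ L (|c| − 1) − |c| ≤ (L − 1)² − 1.

open import Defs
open import Data.Nat using (ℕ; zero; suc; _≤_; _<_; _+_; _*_; _∸_; _^_; z≤n; s≤s)
open import Data.Nat.Properties
open import Algebra.Properties.CommutativeSemigroup +-commutativeSemigroup using (x∙yz≈y∙xz)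
open import Data.Fin using (Fin)
import Data.Fin.Properties as Fin
open import Data.List using (List; []; _∷_; _++_; [_]; length; concat; filter; cartesianProductWith; allFin)
open import Data.List.Properties using (length-++; length-removeAt′; length-tabulate)
open import Data.List.Extrema.Nat using (argmax; argmax-all; f[xs]≤f[argmax])
open import Data.List.Membership.Propositional using (_∈_; _∉_; _─_; find; lose)
open import Data.List.Membership.Propositional.Properties
  using (∈-++⁺ˡ; ∈-cartesianProductWith⁺; ∈-filter⁺; ∈-allFin)
open import Data.List.Relation.Binary.Disjoint.Propositional using (Disjoint)
open import Data.List.Relation.Binary.Disjoint.Propositional.Properties using (concat⁺ʳ)
open import Data.List.Relation.Binary.Subset.Propositional using (_⊆_)
open import Data.List.Relation.Binary.Subset.Propositional.Properties
  using (All-resp-⊇; concat⁺; ∈-∷⁺ʳ; xs⊆ys++xs)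
open import Data.List.Relation.Unary.Any using (here; there; index; any?)
open import Data.List.Relation.Unary.All as All using (All; []; _∷_; all?)
open import Data.List.Relation.Unary.All.Properties using (¬Any⇒All¬; all-filter)
import Data.List.Relation.Unary.All.Properties as All
open import Data.List.Relation.Unary.Unique.Propositional using (Unique; []; _∷_)
open import Data.List.Relation.Unary.Unique.Propositional.Properties using (++⁺)
open import Data.Product using (_×_; _,_; proj₂; ∃)
open import Data.Unit using (tt)
open import Function using (_∘_)
open import Relation.Binary.Definitions using (DecidableEquality)
open import Relation.Binary.PropositionalEquality using (_≢_; refl; sym; cong)
open import Relation.Nullary using (Dec; yes; no; contradiction)
open import Relation.Nullary.Decidable using (_×-dec_; T?)
open import Relation.Unary using (Pred; Decidable)

m<n≤o⇒o*m≤n+[[o∸1]^2∸1] : ∀ {m n o} → m < n → n ≤ o → o * m ≤ n + ((o ∸ 1) ^ 2 ∸ 1)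
m<n≤o⇒o*m≤n+[[o∸1]^2∸1] {m} {suc n} {suc o} (s≤s m≤n) (s≤s n≤o) = begin
  suc o * m            ≤⟨ *-monoʳ-≤ (suc o) m≤n ⟩
  n + o * n            ≤⟨ +-monoʳ-≤ n (*-monoʳ-≤ o n≤o) ⟩
  n + o * o            ≡⟨ cong (λ k → n + o * k) (sym (*-identityʳ o)) ⟩
  n + o ^ 2            ≤⟨ +-monoʳ-≤ n (m≤n+m∸n (o ^ 2) 1) ⟩
  n + suc (o ^ 2 ∸ 1)  ≡⟨ +-suc n _ ⟩
  suc n + (o ^ 2 ∸ 1)  ∎
  where open ≤-Reasoning

module _ {A : Set} where

  ∈-─ : ∀ {x y : A} {ys} (x∈ys : x ∈ ys) → y ∈ ys → y ≢ x → y ∈ ys ─ x∈ys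
  ∈-─ (here refl) (here refl)  y≢x = contradiction refl y≢x
  ∈-─ (here refl) (there y∈ys) _   = y∈ys
  ∈-─ (there _)   (here refl)  _   = here refl
  ∈-─ (there x∈ys) (there y∈ys) y≢x = there (∈-─ x∈ys y∈ys y≢x)

  Unique-⊆⇒length≤ : ∀ {xs ys : List A} → Unique xs → xs ⊆ ys → length xs ≤ length ys
  Unique-⊆⇒length≤ [] _ = z≤n
  Unique-⊆⇒length≤ {x ∷ xs} {ys} (x∉xs ∷ xs-unique) x∷xs⊆ys = begin
    suc (length xs)           ≤⟨ s≤s (Unique-⊆⇒length≤ xs-unique xs⊆ys─x) ⟩
    suc (length (ys ─ x∈ys))  ≡⟨ sym (length-removeAt′ ys (index x∈ys)) ⟩
    length ys                 ∎
    where
    open ≤-Reasoning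
    x∈ys = x∷xs⊆ys (here refl)
    xs⊆ys─x : xs ⊆ ys ─ x∈ys
    xs⊆ys─x y∈xs = ∈-─ x∈ys (x∷xs⊆ys (there y∈xs)) (All.lookup x∉xs y∈xs ∘ sym)

  Unique-∷ : ∀ {x : A} {xs} → x ∉ xs → Unique xs → Unique (x ∷ xs)
  Unique-∷ {xs = xs} x∉xs xs-unique = ¬Any⇒All¬ xs x∉xs ∷ xs-unique

  Unique-++⁻ : ∀ (xs : List A) {ys} → Unique (xs ++ ys) → Unique xs × Unique ys × Disjoint xs ys
  Unique-++⁻ [] ys-unique = [] , ys-unique , λ ()
  Unique-++⁻ (x ∷ xs) (x∉ ∷ xs++ys-unique) with Unique-++⁻ xs xs++ys-unique
  ... | xs-unique , ys-unique , xs#ys = All.++⁻ˡ xs x∉ ∷ xs-unique , ys-unique , x∷xs#ys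
    where
    x∷xs#ys : Disjoint (x ∷ xs) _
    x∷xs#ys (here refl , x∈ys) = All.lookup (All.++⁻ʳ xs x∉) x∈ys refl
    x∷xs#ys (there v∈xs , v∈ys) = xs#ys (v∈xs , v∈ys)

  length≤length-concat : ∀ {xss : List (List A)} → All (λ xs → 1 ≤ length xs) xss →
                         length xss ≤ length (concat xss)
  length≤length-concat [] = z≤n
  length≤length-concat {xs ∷ xss} (1≤|xs| ∷ nonempty) = begin
    1 + length xss                  ≤⟨ +-mono-≤ 1≤|xs| (length≤length-concat nonempty) ⟩
    length xs + length (concat xss) ≡⟨ sym (length-++ xs) ⟩
    length (xs ++ concat xss)       ∎
    where open ≤-Reasoning

  boundedLists : List A → ℕ → List (List A)
  boundedLists es zero    = [ [] ]
  boundedLists es (suc k) = [] ∷ cartesianProductWith _∷_ es (boundedLists es k)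

  ∈-boundedLists : ∀ {es xs} k → length xs ≤ k → xs ⊆ es → xs ∈ boundedLists es k
  ∈-boundedLists {xs = []}     zero    _ _ = here refl
  ∈-boundedLists {xs = []}     (suc k) _ _ = here refl
  ∈-boundedLists {xs = x ∷ xs} (suc k) (s≤s |xs|≤k) x∷xs⊆es =
    there (∈-cartesianProductWith⁺ _∷_ (x∷xs⊆es (here refl)) (∈-boundedLists k |xs|≤k (x∷xs⊆es ∘ there)))

  maximum-exists : ∀ {ℓ} {P : Pred A ℓ} → Decidable P → (f : A → ℕ) →
                   ∀ {a} xs → P a → (∀ {y} → P y → y ∈ xs) →
                   ∃ λ m → P m × (∀ y → P y → f y ≤ f m)
  maximum-exists P? f {a} xs pa xs-complete =
    argmax f a candidates ,
    argmax-all f pa (all-filter P? xs) ,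
    λ y py → All.lookup (f[xs]≤f[argmax] a candidates) (∈-filter⁺ P? (xs-complete py) py)
    where candidates = filter P? xs

module _ {A : Set} (_≟_ : DecidableEquality A) (L : ℕ) (c : List A) where
  open import Data.List.Membership.DecPropositional _≟_ using (_∈?_)

  -- Each member of xss meeting c is dropped and leaves one of its elements in c behind in hits.
  record Decomposition (xss : List (List A)) : Set where
    field
      avoiding           : List (List A)
      hits               : List A
      avoiding⊆          : avoiding ⊆ xss
      avoiding-unique    : Unique (concat avoiding)
      avoiding-disjoint  : All (Disjoint c) avoiding
      hits-unique        : Unique hits
      hits⊆c             : hits ⊆ c
      hits⊆covered       : hits ⊆ concat xss
      length-concat≤     : length (concat xss) ≤ length (concat avoiding) + L * length hits

  open Decomposition

  []-decomposition : Decomposition []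
  []-decomposition = record
    { avoiding = [] ; hits = [] ; avoiding⊆ = λ () ; avoiding-unique = [] ; avoiding-disjoint = []
    ; hits-unique = [] ; hits⊆c = λ () ; hits⊆covered = λ () ; length-concat≤ = z≤n }

  ∷-avoiding : ∀ {r xss} → Disjoint c r → Unique r → Disjoint r (concat xss) →
               Decomposition xss → Decomposition (r ∷ xss)
  ∷-avoiding {r} {xss} c#r r-unique r#xss D = record
    { avoiding          = r ∷ avoiding D
    ; hits              = hits D
    ; avoiding⊆         = λ { (here refl) → here refl ; (there r′∈) → there (avoiding⊆ D r′∈) }
    ; avoiding-unique   = ++⁺ r-unique (avoiding-unique D) (λ (v∈r , v∈) → r#xss (v∈r , concat⁺ (avoiding⊆ D) v∈))
    ; avoiding-disjoint = c#r ∷ avoiding-disjoint D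
    ; hits-unique       = hits-unique D
    ; hits⊆c            = hits⊆c D
    ; hits⊆covered      = xs⊆ys++xs _ r ∘ hits⊆covered D
    ; length-concat≤    = begin
        length (r ++ concat xss)           ≡⟨ length-++ r ⟩
        length r + length (concat xss)     ≤⟨ +-monoʳ-≤ (length r) (length-concat≤ D) ⟩
        length r + (k + L * w)             ≡⟨ sym (+-assoc (length r) k (L * w)) ⟩
        length r + k + L * w               ≡⟨ cong (_+ L * w) (sym (length-++ r)) ⟩
        length (r ++ concat kept) + L * w  ∎ }
    where
    open ≤-Reasoning
    kept = avoiding D
    k = length (concat kept)
    w = length (hits D)

  ∷-meeting : ∀ {r xss x} → x ∈ r → x ∈ c → length r ≤ L → Disjoint r (concat xss) →
              Decomposition xss → Decomposition (r ∷ xss)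
  ∷-meeting {r} {xss} {x} x∈r x∈c |r|≤L r#xss D = record
    { avoiding          = avoiding D
    ; hits              = x ∷ hits D
    ; avoiding⊆         = there ∘ avoiding⊆ D
    ; avoiding-unique   = avoiding-unique D
    ; avoiding-disjoint = avoiding-disjoint D
    ; hits-unique       = Unique-∷ (λ x∈hits → r#xss (x∈r , hits⊆covered D x∈hits)) (hits-unique D)
    ; hits⊆c            = ∈-∷⁺ʳ x∈c (hits⊆c D)
    ; hits⊆covered      = ∈-∷⁺ʳ (∈-++⁺ˡ x∈r) (xs⊆ys++xs _ r ∘ hits⊆covered D)
    ; length-concat≤    = begin
        length (r ++ concat xss)        ≡⟨ length-++ r ⟩
        length r + length (concat xss)  ≤⟨ +-mono-≤ |r|≤L (length-concat≤ D) ⟩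
        L + (k + L * w)                 ≡⟨ x∙yz≈y∙xz L k (L * w) ⟩
        k + (L + L * w)                 ≡⟨ cong (k +_) (sym (*-suc L w)) ⟩
        k + L * suc w                   ∎ }
    where
    open ≤-Reasoning
    k = length (concat (avoiding D))
    w = length (hits D)

  decompose : ∀ xss → All (λ r → length r ≤ L) xss → Unique (concat xss) → Decomposition xss
  decompose [] _ _ = []-decomposition
  decompose (r ∷ xss) (|r|≤L ∷ bounded) unique with Unique-++⁻ r unique | any? (_∈? c) r
  ... | r-unique , xss-unique , r#xss | yes r∩c =
    let x , x∈r , x∈c = find r∩c in ∷-meeting x∈r x∈c |r|≤L r#xss (decompose xss bounded xss-unique)
  ... | r-unique , xss-unique , r#xss | no r#c =
    ∷-avoiding (λ (v∈c , v∈r) → r#c (lose v∈r v∈c)) r-unique r#xss (decompose xss bounded xss-unique)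

module _ {n : ℕ} (G : Digraph n) (L : ℕ) where
  open import Data.List.Relation.Unary.Unique.DecPropositional (Fin._≟_ {n}) using (unique?)

  pathArcs? : ∀ vs → Dec (PathArcs G vs)
  pathArcs? []          = yes tt
  pathArcs? (x ∷ [])    = yes tt
  pathArcs? (x ∷ y ∷ r) = T? (G x y) ×-dec pathArcs? (y ∷ r)

  closedArcs? : ∀ vs → Dec (ClosedArcs G vs)
  closedArcs? []       = no λ ()
  closedArcs? (v ∷ vs) = pathArcs? (v ∷ vs ++ [ v ])

  isShortCycle? : Decidable (IsShortCycle G L)
  isShortCycle? c = ((2 ≤? length c) ×-dec (unique? c ×-dec closedArcs? c)) ×-dec (length c ≤? L)

  isPacking? : Decidable (IsPacking G L)
  isPacking? P = all? isShortCycle? P ×-dec unique? (covered P)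

  IsPacking⇒∈boundedLists : ∀ {P} → IsPacking G L P → P ∈ boundedLists (boundedLists (allFin n) L) n
  IsPacking⇒∈boundedLists {P} (P-cycles , P-unique) =
    ∈-boundedLists n |P|≤n (λ {c} c∈P → ∈-boundedLists L (proj₂ (All.lookup P-cycles c∈P)) (λ _ → ∈-allFin _))
    where
    |P|≤n : length P ≤ n
    |P|≤n = begin
      length P          ≤⟨ length≤length-concat (All.map (λ ((2≤|c| , _) , _) → ≤-trans (s≤s z≤n) 2≤|c|) P-cycles) ⟩
      length (concat P) ≤⟨ Unique-⊆⇒length≤ P-unique (λ _ → ∈-allFin _) ⟩
      length (allFin n) ≡⟨ length-tabulate (λ i → i) ⟩
      n                 ∎
      where open ≤-Reasoning

  maximumPacking : ∃ λ M → IsPacking G L M × (∀ P → IsPacking G L P → size P ≤ size M)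
  maximumPacking = maximum-exists isPacking? size _ ([] , []) IsPacking⇒∈boundedLists

  reroute : ∀ {M c v} → IsPacking G L M → IsShortCycle G L c → v ∈ c → v ∉ covered M →
            ∃ λ P → IsPacking G L P × v ∈ covered P × size M ≤ size P + ((L ∸ 1) ^ 2 ∸ 1)
  reroute {M} {c} {v} (M-cycles , M-unique) c-cycle@((_ , c-unique , _) , |c|≤L) v∈c v∉M =
    c ∷ avoiding ,
    (c-cycle ∷ All-resp-⊇ avoiding⊆ M-cycles , ++⁺ c-unique avoiding-unique (concat⁺ʳ avoiding-disjoint)) ,
    ∈-++⁺ˡ v∈c ,
    size-bound
    where
    open Decomposition (decompose Fin._≟_ L c M (All.map proj₂ M-cycles) M-unique)
    B = (L ∸ 1) ^ 2 ∸ 1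

    hits<|c| : length hits < length c
    hits<|c| = Unique-⊆⇒length≤ (Unique-∷ (v∉M ∘ hits⊆covered) hits-unique) (∈-∷⁺ʳ v∈c hits⊆c)

    size-bound : size M ≤ size (c ∷ avoiding) + B
    size-bound = begin
      size M                           ≤⟨ length-concat≤ ⟩
      size avoiding + L * length hits  ≤⟨ +-monoʳ-≤ (size avoiding) (m<n≤o⇒o*m≤n+[[o∸1]^2∸1] hits<|c| |c|≤L) ⟩
      size avoiding + (length c + B)   ≡⟨ x∙yz≈y∙xz (size avoiding) (length c) B ⟩
      length c + (size avoiding + B)   ≡⟨ sym (+-assoc (length c) _ B) ⟩
      length c + size avoiding + B     ≡⟨ cong (_+ B) (sym (length-++ c)) ⟩
      size (c ∷ avoiding) + B          ∎
      where open ≤-Reasoning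

cyclePackingBound : ∀ L n (G : Digraph n) (v : Fin n) → (∃ λ c → IsShortCycle G L c × v ∈ c) →
  ∃ λ P → IsPacking G L P × v ∈ covered P ×
    (∀ Q → IsPacking G L Q → size Q ≤ size P + ((L ∸ 1) ^ 2 ∸ 1))
cyclePackingBound L n G v (c , c-cycle , v∈c) with maximumPacking G L
... | M , M-packing , M-maximum with any? (v Fin.≟_) (covered M)
...   | yes v∈M = M , M-packing , v∈M , λ Q Q-packing → ≤-trans (M-maximum Q Q-packing) (m≤m+n _ _)
...   | no v∉M with reroute G L M-packing c-cycle v∈c v∉M
...     | P , P-packing , v∈P , M≤P = P , P-packing , v∈P , λ Q Q-packing → ≤-trans (M-maximum Q Q-packing) M≤P

proposition1 :
    (∀ (n : ℕ) (G : Digraph n) (v : Fin n) →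
      (∃ λ c → IsShortCycle G 3 c × v ∈ c) →
      ∃ λ P → IsPacking G 3 P × v ∈ covered P ×
        (∀ Q → IsPacking G 3 Q → size Q ≤ size P + 3))
    ×
    (∀ (L n : ℕ) (G : Digraph n) (v : Fin n) →
      (∃ λ c → IsShortCycle G L c × v ∈ c) →
      ∃ λ P → IsPacking G L P × v ∈ covered P ×
        (∀ Q → IsPacking G L Q → size Q ≤ size P + ((L ∸ 1) ^ 2 ∸ 1)))
-- (3 ∸ 1) ^ 2 ∸ 1 computes to 3.
proposition1 = cyclePackingBound 3 , cyclePackingBound
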